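{- Let $\mathbb F,\mathbb F'$ be fields of characteristic zero, $q\in\mathbb F^*$, $q'\in(\mathbb F')^*$ not roots of unity, and let $i:\mathbb F\to\mathbb F'$ be a field isomorphism with $i(q)=q'$. Then $i$ extends to an isomorphism from the quantum 2-torus $T_q^2(\mathbb F)$ onto the quantum 2-torus $T_{q'}^2(\mathbb F')$. In particular the isomorphism type of a quantum 2-torus does not depend on the choice function.
   Context: $\Gamma=q^{\mathbb Z}$. A choice function is $\phi:\mathbb F^*/\Gamma\to\mathbb F^*$ with $\phi(x\Gamma)\in x\Gamma$; $\Phi$ is its range. For $(u,v)\in\Phi^2$, $\gamma\in\Gamma$ take linearly independent vectors $\mathbf u(\gamma u,v)$, $\mathbf v(\gamma v,u)$ of a large $\mathbb F$-module; $\mathbf U_\phi=\{\gamma_1\mathbf u(\gamma_2u,v)\}$, $\mathbf V_\phi=\{\gamma_1\mathbf v(\gamma_2v,u)\}$ ($\gamma_i\in\Gamma$, $(u,v)\in\Phi^2$), with line-bundles $\mathbb F^*\mathbf U_\phi,\mathbb F^*\mathbf V_\phi$ of scalar multiples. Operators act linearly: $U\mathbf u(\gamma u,v)=\gamma u\,\mathbf u(\gamma u,v)$, $V\mathbf u(\gamma u,v)=v\,\mathbf u(q^{ -1}\gamma u,v)$, $U\mathbf v(\gamma v,u)=u\,\mathbf v(q\gamma v,u)$, $V\mathbf v(\gamma v,u)=\gamma v\,\mathbf v(\gamma v,u)$, plus inverses. The pairing is a partial function $\langle\cdot|\cdot\rangle:(\mathbf V_\phi\times\mathbf U_\phi)\cup(\mathbf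 U_\phi\times\mathbf V_\phi)\to\Gamma$ with: $\langle\mathbf u(u,v)|\mathbf v(v,u)\rangle=1$; $\langle U^rV^s\mathbf u(u,v)|U^rV^s\mathbf v(v,u)\rangle=1$ ($r,s\in\mathbb Z$); $\langle\gamma_1\mathbf u(\gamma_2u,v)|\gamma_3\mathbf v(\gamma_4v,u)\rangle=\langle\gamma_3\mathbf v(\gamma_4v,u)|\gamma_1\mathbf u(\gamma_2u,v)\rangle^{ -1}=\gamma_1^{ -1}\gamma_3\langle\mathbf u(\gamma_2u,v)|\mathbf v(\gamma_4v,u)\rangle$; undefined between fibres over different $\Gamma$-cosets. The quantum 2-torus is $T_q^2(\mathbb F)=(\mathbf U_\phi,\mathbf V_\phi,\langle\cdot|\cdot\rangle,\mathbb F)$ with these operators and pairing. -}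

module Defs where

open import Level using (Level; _⊔_) renaming (suc to lsuc)
open import Data.Nat using (ℕ; zero; suc)
open import Data.Integer using (ℤ; +_; -[1+_]) renaming (_+_ to _+ℤ_; _-_ to _-ℤ_; _*_ to _*ℤ_; -_ to -ℤ_)
open import Data.Product using (Σ; ∃; _×_; _,_; proj₁; proj₂)
open import Relation.Nullary using (¬_)
open import Relation.Binary.PropositionalEquality using (_≡_)
open import Algebra.Bundles using (CommutativeRing)
open import Algebra.Morphism.Structures using (IsRingIsomorphism)
open import Function.Bundles using (_⇔_)
import Relation.Binary.Reasoning.Setoid as SetoidReasoning

record Field (c ℓ : Level) : Set (lsuc (c ⊔ ℓ)) where
  field
    commutativeRing : CommutativeRing c ℓ
  open CommutativeRing commutativeRing public
  field
    1≉0     : ¬ (1# ≈ 0#)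
    inverse : ∀ x → ¬ (x ≈ 0#) → ∃ λ y → x * y ≈ 1#

module FieldTheory {c ℓ} (F : Field c ℓ) where
  open Field F

  fromℕ : ℕ → Carrier
  fromℕ zero    = 0#
  fromℕ (suc n) = 1# + fromℕ n

  CharZero : Set ℓ
  CharZero = ∀ n → ¬ (fromℕ (suc n) ≈ 0#)

  _^_ : Carrier → ℕ → Carrier
  x ^ zero  = 1#
  x ^ suc n = x * (x ^ n)

  NotRootOfUnity : Carrier → Set ℓ
  NotRootOfUnity x = ∀ n → ¬ ((x ^ suc n) ≈ 1#)

  record NZ : Set (c ⊔ ℓ) where
    constructor nz
    field
      val    : Carrier
      val≉0  : ¬ (val ≈ 0#)
  open NZ public

  private
    no-zero-div : ∀ x y → ¬ (x ≈ 0#) → ¬ (y ≈ 0#) → ¬ (x * y ≈ 0#)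
    no-zero-div x y x≉0 y≉0 xy≈0 = y≉0 y≈0
      where
        open SetoidReasoning setoid
        x' = proj₁ (inverse x x≉0)
        xx' = proj₂ (inverse x x≉0)
        y≈0 : y ≈ 0#
        y≈0 = begin
          y               ≈⟨ sym (*-identityˡ y) ⟩
          1# * y          ≈⟨ *-congʳ (sym xx') ⟩
          (x * x') * y    ≈⟨ *-congʳ (*-comm x x') ⟩
          (x' * x) * y    ≈⟨ *-assoc x' x y ⟩
          x' * (x * y)    ≈⟨ *-congˡ xy≈0 ⟩
          x' * 0#         ≈⟨ zeroʳ x' ⟩
          0#              ∎

    inv≉0 : ∀ x (p : ¬ (x ≈ 0#)) → ¬ (proj₁ (inverse x p) ≈ 0#)
    inv≉0 x p y≈0 = 1≉0 (trans (sym (proj₂ (inverse x p)))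
                            (trans (*-congˡ y≈0) (zeroʳ x)))

  infixl 7 _·_
  infix 8 _⁻¹
  infixr 8 _^ℤ_

  one* : NZ
  one* = nz 1# 1≉0

  _·_ : NZ → NZ → NZ
  a · b = nz (val a * val b) (no-zero-div (val a) (val b) (val≉0 a) (val≉0 b))

  _⁻¹ : NZ → NZ
  a ⁻¹ = nz (proj₁ (inverse (val a) (val≉0 a))) (inv≉0 (val a) (val≉0 a))

  pow* : NZ → ℕ → NZ
  pow* a zero    = one*
  pow* a (suc n) = a · pow* a n

  _^ℤ_ : NZ → ℤ → NZ
  a ^ℤ (+ n)     = pow* a n
  a ^ℤ -[1+ n ]  = pow* (a ⁻¹) (suc n)

-- Choice functions  φ : F*/Γ → F*,  Γ = q^ℤ.
-- A function on the quotient F*/Γ is represented by a function on F*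
-- that is constant on Γ-cosets; φ(xΓ) ∈ xΓ.

module Torus {c ℓ} (F : Field c ℓ) (q : FieldTheory.NZ F) where
  open Field F
  open FieldTheory F

  InCoset : NZ → NZ → Set ℓ
  InCoset x y = ∃ λ (n : ℤ) → val y ≈ val (q ^ℤ n) * val x

  InΓ : NZ → Set ℓ
  InΓ a = ∃ λ (n : ℤ) → val a ≈ val (q ^ℤ n)

  record ChoiceFunction : Set (c ⊔ ℓ) where
    field
      φ        : NZ → NZ
      φ-coset  : ∀ x → InCoset x (φ x)
      φ-const  : ∀ x y → InCoset x y → val (φ x) ≈ val (φ y)

  module _ (ch : ChoiceFunction) where
    open ChoiceFunction ch

    InΦ : NZ → Set (c ⊔ ℓ)
    InΦ y = ∃ λ x → val (φ x) ≈ val y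

    -- Elements of the line bundles.
    --   as an element of F*U_φ :  coef · u(q^idx u , v)
    --   as an element of F*V_φ :  coef · v(q^idx v , u)
    -- with (u , v) ∈ Φ².  The vectors u(γu,v), v(γv,u) are linearly
    -- independent, so these data determine the element uniquely.
    record Elt : Set (c ⊔ ℓ) where
      constructor elt
      field
        coef : NZ
        idx  : ℤ
        u    : NZ
        v    : NZ
        u∈Φ  : InΦ u
        v∈Φ  : InΦ v
    open Elt public

    _≈E_ : Elt → Elt → Set ℓ
    a ≈E b = (val (coef a) ≈ val (coef b)) × (idx a ≡ idx b)
             × (val (u a) ≈ val (u b)) × (val (v a) ≈ val (v b))

    private
      reidx : Elt → NZ → ℤ → Elt
      reidx (elt _ _ x y px py) c' n' = elt c' n' x y px py

    _∙_ : NZ → Elt → Elt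
    x ∙ a = reidx a (x · coef a) (idx a)

    -- the operators on F*U_φ
    --  U u(γu,v) = γu u(γu,v),  V u(γu,v) = v u(q⁻¹γu,v)
    U-onU U⁻¹-onU V-onU V⁻¹-onU : Elt → Elt
    U-onU   a = reidx a (coef a · ((q ^ℤ idx a) · u a)) (idx a)
    U⁻¹-onU a = reidx a (coef a · (((q ^ℤ idx a) · u a) ⁻¹)) (idx a)
    V-onU   a = reidx a (coef a · v a) (idx a -ℤ + 1)
    V⁻¹-onU a = reidx a (coef a · (v a ⁻¹)) (idx a +ℤ + 1)

    -- the operators on F*V_φ
    --  U v(γv,u) = u v(qγv,u),  V v(γv,u) = γv v(γv,u)
    U-onV U⁻¹-onV V-onV V⁻¹-onV : Elt → Elt
    U-onV   a = reidx a (coef a · u a) (idx a +ℤ + 1)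
    U⁻¹-onV a = reidx a (coef a · (u a ⁻¹)) (idx a -ℤ + 1)
    V-onV   a = reidx a (coef a · ((q ^ℤ idx a) · v a)) (idx a)
    V⁻¹-onV a = reidx a (coef a · (((q ^ℤ idx a) · v a) ⁻¹)) (idx a)

    -- membership in U_φ (resp. V_φ): coefficient in Γ
    InBasis : Elt → Set ℓ
    InBasis a = InΓ (coef a)

    PairDefined : Elt → Elt → Set ℓ
    PairDefined a b = (val (u a) ≈ val (u b)) × (val (v a) ≈ val (v b))

    -- ⟨γ₁ u(q^m u,v) | γ₃ v(q^n v,u)⟩ = γ₁⁻¹ γ₃ q^{mn}
    -- (the unique value forced by the axioms)
    pairUV : Elt → Elt → Carrier
    pairUV a b = val (((coef a) ⁻¹ · coef b) · (q ^ℤ (idx a *ℤ idx b)))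

    pairVU : Elt → Elt → Carrier
    pairVU b a = val ((((coef a) ⁻¹ · coef b) · (q ^ℤ (idx a *ℤ idx b))) ⁻¹)

module _ {c ℓ c' ℓ'} (F : Field c ℓ) (F' : Field c' ℓ') where
  private
    module F  = Field F
    module F' = Field F'
    module TF  = FieldTheory F
    module TF' = FieldTheory F'

  IsFieldIsomorphism : (F.Carrier → F'.Carrier) → Set (c ⊔ c' ⊔ ℓ ⊔ ℓ')
  IsFieldIsomorphism i = IsRingIsomorphism F.rawRing F'.rawRing i

  module _ (q : TF.NZ) (q' : TF'.NZ)
           (φ : Torus.ChoiceFunction F q) (φ' : Torus.ChoiceFunction F' q') where
    private
      module T  = Torus F q
      module T' = Torus F' q'

      E : Set (c ⊔ ℓ)
      E = T.Elt φ
      E' : Set (c' ⊔ ℓ')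
      E' = T'.Elt φ'
      _≈₁_ : E → E → Set ℓ
      _≈₁_ = T._≈E_ φ
      _≈₂_ : E' → E' → Set ℓ'
      _≈₂_ = T'._≈E_ φ'
      _∙₁_ : TF.NZ → E → E
      _∙₁_ = T._∙_ φ
      _∙₂_ : TF'.NZ → E' → E'
      _∙₂_ = T'._∙_ φ'

    BijectionOn : (E → E') → Set (c ⊔ c' ⊔ ℓ ⊔ ℓ')
    BijectionOn f = (∀ a b → a ≈₁ b → f a ≈₂ f b)
                  × (∀ a b → f a ≈₂ f b → a ≈₁ b)
                  × (∀ b → ∃ λ a → f a ≈₂ b)

    module _ (i : F.Carrier → F'.Carrier) (fU fV : E → E') where

      Semilinear : Set (c ⊔ c' ⊔ ℓ ⊔ ℓ')
      Semilinear =
          (∀ (x : TF.NZ) (x' : TF'.NZ) (a : E) →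
             F'._≈_ (TF'.val x') (i (TF.val x)) → fU (x ∙₁ a) ≈₂ (x' ∙₂ fU a))
        × (∀ (x : TF.NZ) (x' : TF'.NZ) (a : E) →
             F'._≈_ (TF'.val x') (i (TF.val x)) → fV (x ∙₁ a) ≈₂ (x' ∙₂ fV a))

      CommutesWithOperators : Set (c ⊔ ℓ ⊔ ℓ')
      CommutesWithOperators =
          (∀ (a : E) → fU (T.U-onU φ a)   ≈₂ T'.U-onU φ' (fU a))
        × (∀ (a : E) → fU (T.U⁻¹-onU φ a) ≈₂ T'.U⁻¹-onU φ' (fU a))
        × (∀ (a : E) → fU (T.V-onU φ a)   ≈₂ T'.V-onU φ' (fU a))
        × (∀ (a : E) → fU (T.V⁻¹-onU φ a) ≈₂ T'.V⁻¹-onU φ' (fU a))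
        × (∀ (a : E) → fV (T.U-onV φ a)   ≈₂ T'.U-onV φ' (fV a))
        × (∀ (a : E) → fV (T.U⁻¹-onV φ a) ≈₂ T'.U⁻¹-onV φ' (fV a))
        × (∀ (a : E) → fV (T.V-onV φ a)   ≈₂ T'.V-onV φ' (fV a))
        × (∀ (a : E) → fV (T.V⁻¹-onV φ a) ≈₂ T'.V⁻¹-onV φ' (fV a))

      PreservesBasis : Set (c ⊔ ℓ ⊔ ℓ')
      PreservesBasis =
          (∀ (a : E) → T.InBasis φ a ⇔ T'.InBasis φ' (fU a))
        × (∀ (a : E) → T.InBasis φ a ⇔ T'.InBasis φ' (fV a))

      PairingDomain : Set (c ⊔ ℓ ⊔ ℓ')
      PairingDomain = ∀ (a b : E) → T.InBasis φ a → T.InBasis φ b →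
        T.PairDefined φ a b ⇔ T'.PairDefined φ' (fU a) (fV b)

      PairingValueUV : Set (c ⊔ ℓ ⊔ ℓ')
      PairingValueUV = ∀ (a b : E) → T.InBasis φ a → T.InBasis φ b →
        T.PairDefined φ a b →
        F'._≈_ (i (T.pairUV φ a b)) (T'.pairUV φ' (fU a) (fV b))

      PairingValueVU : Set (c ⊔ ℓ ⊔ ℓ')
      PairingValueVU = ∀ (a b : E) → T.InBasis φ a → T.InBasis φ b →
        T.PairDefined φ a b →
        F'._≈_ (i (T.pairVU φ b a)) (T'.pairVU φ' (fV b) (fU a))

      PreservesPairing : Set (c ⊔ ℓ ⊔ ℓ')
      PreservesPairing = PairingDomain × PairingValueUV × PairingValueVU

    -- An isomorphism T_q^2(F) → T_q'^2(F') extending i: on the field sort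
    -- it is i itself; on the line bundles F*U_φ, F*V_φ it is given by
    -- bijections fU, fV compatible with all the structure.
    TorusIsomorphism : (i : F.Carrier → F'.Carrier) → Set (c ⊔ c' ⊔ ℓ ⊔ ℓ')
    TorusIsomorphism i =
      Σ (E → E') λ fU → Σ (E → E') λ fV →
        BijectionOn fU × BijectionOn fV × Semilinear i fU fV
        × CommutesWithOperators i fU fV × PreservesBasis i fU fV
        × PreservesPairing i fU fV

module Submission where

-- Write τ u = φ'(i u) ∈ Φ' and i u = q'^(δ u) · τ u; the offset δ u is well defined because q' is
-- not a root of unity, and τ : Φ → Φ' is a bijection because i maps Γ-cosets onto Γ'-cosets.
-- The isomorphism is
--   c · u(q^m u, v) ↦ i(c) q'^(δv·m)        · u(q'^(m+δu) τu, τv),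
--   c · v(q^n v, u) ↦ i(c) q'^(-δu·(n+δv))  · v(q'^(n+δv) τv, τu):
-- the index shift makes U match, since i(q^m u) = q'^(m+δu) τu, while the scalar weight compensates
-- for V acting through i v = q'^δv τv instead of τv (dually for the v-vectors).  The two weights
-- preserve the pairing c⁻¹ d q^(mn), because -δv·m - δu·(n+δv) + (m+δu)(n+δv) = mn.

open import Defs
open import Data.Nat using (zero; suc)
open import Data.Integer.Base using (ℤ; +_; -[1+_]; +0; +[1+_]; 1ℤ)
  renaming (suc to sucℤ; _+_ to _+ℤ_; _-_ to _-ℤ_; _*_ to _*ℤ_; -_ to -ℤ_)
import Data.Integer.Properties as ℤ
open import Data.Integer.Tactic.RingSolver using (solve-∀)
open import Data.Product using (∃; _×_; _,_; proj₁; proj₂)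
open import Relation.Nullary using (¬_)
open import Algebra.Morphism.Structures using (module RingMorphisms)
open import Data.Empty using (⊥-elim)
open import Relation.Binary.PropositionalEquality as ≡ using (_≡_)
import Algebra.Properties.CommutativeSemigroup as CommSemigroupProperties
import Algebra.Properties.AbelianGroup as AbelianGroupProperties
open import Function.Bundles using (_⇔_; mk⇔)
import Relation.Binary.Reasoning.Setoid as SetoidReasoning

private module ℤ+ = AbelianGroupProperties ℤ.+-0-abelianGroup

module FieldInverses {c ℓ} (F : Field c ℓ) where
  open Field F
  open FieldTheory F
  open SetoidReasoning setoid
  open CommSemigroupProperties *-commutativeSemigroup using (interchange)

  ⁻¹-inverseʳ : ∀ a → val a * val (a ⁻¹) ≈ 1#
  ⁻¹-inverseʳ a = proj₂ (inverse (val a) (val≉0 a))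

  ⁻¹-inverseˡ : ∀ a → val (a ⁻¹) * val a ≈ 1#
  ⁻¹-inverseˡ a = trans (*-comm _ _) (⁻¹-inverseʳ a)

  *-cancelˡ : ∀ a {y z} → val a * y ≈ val a * z → y ≈ z
  *-cancelˡ a {y} {z} e = begin
    y                        ≈⟨ *-identityˡ y ⟨
    1# * y                   ≈⟨ *-congʳ (⁻¹-inverseˡ a) ⟨
    (val (a ⁻¹) * val a) * y ≈⟨ *-assoc _ _ _ ⟩
    val (a ⁻¹) * (val a * y) ≈⟨ *-congˡ e ⟩
    val (a ⁻¹) * (val a * z) ≈⟨ *-assoc _ _ _ ⟨
    (val (a ⁻¹) * val a) * z ≈⟨ *-congʳ (⁻¹-inverseˡ a) ⟩
    1# * z                   ≈⟨ *-identityˡ z ⟩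
    z                        ∎

  *-cancelʳ : ∀ a {y z} → y * val a ≈ z * val a → y ≈ z
  *-cancelʳ a e = *-cancelˡ a (trans (*-comm _ _) (trans e (*-comm _ _)))

  ⁻¹-unique : ∀ a {y} → val a * y ≈ 1# → y ≈ val (a ⁻¹)
  ⁻¹-unique a e = *-cancelˡ a (trans e (sym (⁻¹-inverseʳ a)))

  ⁻¹-cong : ∀ {a b} → val a ≈ val b → val (a ⁻¹) ≈ val (b ⁻¹)
  ⁻¹-cong {a} {b} e = ⁻¹-unique b (trans (*-congʳ (sym e)) (⁻¹-inverseʳ a))

  ⁻¹-distrib-· : ∀ a b → val ((a · b) ⁻¹) ≈ val (a ⁻¹) * val (b ⁻¹)
  ⁻¹-distrib-· a b = sym (⁻¹-unique (a · b) (begin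
    (val a * val b) * (val (a ⁻¹) * val (b ⁻¹)) ≈⟨ interchange _ _ _ _ ⟩
    (val a * val (a ⁻¹)) * (val b * val (b ⁻¹)) ≈⟨ *-cong (⁻¹-inverseʳ a) (⁻¹-inverseʳ b) ⟩
    1# * 1#                                     ≈⟨ *-identityˡ 1# ⟩
    1#                                          ∎))

  ⁻¹-swap : ∀ a b {p r} → val a * p ≈ r * val b → val (a ⁻¹) * r ≈ p * val (b ⁻¹)
  ⁻¹-swap a b {p} {r} e = begin
    val (a ⁻¹) * r                           ≈⟨ *-identityʳ _ ⟨
    (val (a ⁻¹) * r) * 1#                    ≈⟨ *-congˡ (⁻¹-inverseʳ b) ⟨
    (val (a ⁻¹) * r) * (val b * val (b ⁻¹))  ≈⟨ *-assoc _ _ _ ⟩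
    val (a ⁻¹) * (r * (val b * val (b ⁻¹)))  ≈⟨ *-congˡ (*-assoc _ _ _) ⟨
    val (a ⁻¹) * ((r * val b) * val (b ⁻¹))  ≈⟨ *-congˡ (*-congʳ e) ⟨
    val (a ⁻¹) * ((val a * p) * val (b ⁻¹))  ≈⟨ *-congˡ (*-assoc _ _ _) ⟩
    val (a ⁻¹) * (val a * (p * val (b ⁻¹)))  ≈⟨ *-assoc _ _ _ ⟨
    (val (a ⁻¹) * val a) * (p * val (b ⁻¹))  ≈⟨ *-congʳ (⁻¹-inverseˡ a) ⟩
    1# * (p * val (b ⁻¹))                    ≈⟨ *-identityˡ _ ⟩
    p * val (b ⁻¹)                           ∎

module IntegerPowers {c ℓ} (F : Field c ℓ) (a : FieldTheory.NZ F) where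
  open Field F
  open FieldTheory F
  open FieldInverses F
  open SetoidReasoning setoid
  open CommSemigroupProperties *-commutativeSemigroup using (interchange)

  a^ : ℤ → Carrier
  a^ n = val (a ^ℤ n)

  pow*-inverse : ∀ n → val (pow* a n) * val (pow* (a ⁻¹) n) ≈ 1#
  pow*-inverse zero    = *-identityˡ 1#
  pow*-inverse (suc n) = begin
    (val a * val (pow* a n)) * (val (a ⁻¹) * val (pow* (a ⁻¹) n)) ≈⟨ interchange _ _ _ _ ⟩
    (val a * val (a ⁻¹)) * (val (pow* a n) * val (pow* (a ⁻¹) n))
      ≈⟨ *-cong (⁻¹-inverseʳ a) (pow*-inverse n) ⟩
    1# * 1#                                                       ≈⟨ *-identityˡ 1# ⟩
    1#                                                            ∎

  ^ℤ-suc : ∀ n → a^ (sucℤ n) ≈ val a * a^ n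
  ^ℤ-suc (+ n)           = refl
  ^ℤ-suc -[1+ zero ]     = sym (trans (*-congˡ (*-identityʳ _)) (⁻¹-inverseʳ a))
  ^ℤ-suc -[1+ suc n ]    =
    sym (trans (sym (*-assoc _ _ _)) (trans (*-congʳ (⁻¹-inverseʳ a)) (*-identityˡ _)))

  private
    ^ℤ-+-pos : ∀ n y → a^ (+ n +ℤ y) ≈ a^ (+ n) * a^ y
    ^ℤ-+-pos zero    y = trans (reflexive (≡.cong a^ (ℤ.+-identityˡ y))) (sym (*-identityˡ _))
    ^ℤ-+-pos (suc n) y = begin
      a^ (+[1+ n ] +ℤ y)        ≡⟨ ≡.cong a^ (ℤ.suc-+ n y) ⟩
      a^ (sucℤ (+ n +ℤ y))      ≈⟨ ^ℤ-suc (+ n +ℤ y) ⟩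
      val a * a^ (+ n +ℤ y)     ≈⟨ *-congˡ (^ℤ-+-pos n y) ⟩
      val a * (a^ (+ n) * a^ y) ≈⟨ *-assoc _ _ _ ⟨
      (val a * a^ (+ n)) * a^ y ∎

  ^ℤ-+ : ∀ x y → a^ (x +ℤ y) ≈ a^ x * a^ y
  ^ℤ-+ (+ n)    y = ^ℤ-+-pos n y
  ^ℤ-+ -[1+ n ] y = begin
    a^ (x +ℤ y)                                 ≈⟨ *-identityˡ _ ⟨
    1# * a^ (x +ℤ y)                            ≈⟨ *-congʳ (trans (*-comm _ _) (pow*-inverse (suc n))) ⟨
    (a^ x * a^ (+[1+ n ])) * a^ (x +ℤ y)        ≈⟨ *-assoc _ _ _ ⟩
    a^ x * (a^ (+[1+ n ]) * a^ (x +ℤ y))        ≈⟨ *-congˡ (^ℤ-+-pos (suc n) (x +ℤ y)) ⟨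
    a^ x * a^ (+[1+ n ] +ℤ (x +ℤ y))            ≡⟨ ≡.cong (λ t → a^ x * a^ t) cancel ⟩
    a^ x * a^ y                                 ∎
    where
      x = -[1+ n ]
      cancel : +[1+ n ] +ℤ (x +ℤ y) ≡ y
      cancel = ≡.trans (≡.sym (ℤ.+-assoc +[1+ n ] x y))
                 (≡.trans (≡.cong (_+ℤ y) (ℤ.+-inverseˡ x)) (ℤ.+-identityˡ y))

  ^ℤ-inverseʳ : ∀ x → a^ x * a^ (-ℤ x) ≈ 1#
  ^ℤ-inverseʳ x = trans (sym (^ℤ-+ x (-ℤ x))) (reflexive (≡.cong a^ (ℤ.+-inverseʳ x)))

  ^ℤ-⁻¹ : ∀ x → val ((a ^ℤ x) ⁻¹) ≈ a^ (-ℤ x)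
  ^ℤ-⁻¹ x = sym (⁻¹-unique (a ^ℤ x) (^ℤ-inverseʳ x))

  pow*≈^ : ∀ n → val (pow* a n) ≈ val a ^ n
  pow*≈^ zero    = refl
  pow*≈^ (suc n) = *-congˡ (pow*≈^ n)

  module _ (a-notRoot : NotRootOfUnity (val a)) where

    ^ℤ≈1⇒≡0 : ∀ d → a^ d ≈ 1# → d ≡ +0
    ^ℤ≈1⇒≡0 (+ zero)  _ = ≡.refl
    ^ℤ≈1⇒≡0 +[1+ k ]  e = ⊥-elim (a-notRoot k (trans (sym (pow*≈^ (suc k))) e))
    ^ℤ≈1⇒≡0 -[1+ k ]  e = ⊥-elim (a-notRoot k (trans (sym (pow*≈^ (suc k))) (begin
      val (pow* a (suc k))                               ≈⟨ *-identityʳ _ ⟨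
      val (pow* a (suc k)) * 1#                          ≈⟨ *-congˡ e ⟨
      val (pow* a (suc k)) * val (pow* (a ⁻¹) (suc k))   ≈⟨ pow*-inverse (suc k) ⟩
      1#                                                 ∎)))

    ^ℤ-injective : ∀ m n → a^ m ≈ a^ n → m ≡ n
    ^ℤ-injective m n e = ℤ.i-j≡0⇒i≡j m n (^ℤ≈1⇒≡0 (m -ℤ n) (begin
      a^ (m +ℤ -ℤ n)    ≈⟨ ^ℤ-+ m (-ℤ n) ⟩
      a^ m * a^ (-ℤ n)  ≈⟨ *-congʳ e ⟩
      a^ n * a^ (-ℤ n)  ≈⟨ ^ℤ-inverseʳ n ⟩
      1#                ∎))

module FieldIsomorphism {c ℓ c' ℓ'} (F : Field c ℓ) (F' : Field c' ℓ')
  (i : Field.Carrier F → Field.Carrier F') (i-iso : IsFieldIsomorphism F F' i) where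
  private
    module A  = Field F
    module AT = FieldTheory F
  open Field F'
  open FieldTheory F'
  open FieldInverses F' using (⁻¹-unique; ⁻¹-cong)
  open RingMorphisms.IsRingIsomorphism i-iso public
    using (*-homo; 1#-homo; 0#-homo; ⟦⟧-cong; injective; surjective)

  i-≉0 : ∀ {x} → ¬ (x A.≈ A.0#) → ¬ (i x ≈ 0#)
  i-≉0 x≉0 ix≈0 = x≉0 (injective (trans ix≈0 (sym 0#-homo)))

  i-NZ : AT.NZ → NZ
  i-NZ a = nz (i (AT.val a)) (i-≉0 (AT.val≉0 a))

  i-⁻¹ : ∀ a → i (AT.val (a AT.⁻¹)) ≈ val (i-NZ a ⁻¹)
  i-⁻¹ a = ⁻¹-unique (i-NZ a)
    (trans (sym (*-homo _ _)) (trans (⟦⟧-cong (FieldInverses.⁻¹-inverseʳ F a)) 1#-homo))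

  i-pow* : ∀ {a a'} → val a' ≈ i (AT.val a) → ∀ n → i (AT.val (AT.pow* a n)) ≈ val (pow* a' n)
  i-pow* e zero    = 1#-homo
  i-pow* e (suc n) = trans (*-homo _ _) (*-cong (sym e) (i-pow* e n))

  i-^ℤ : ∀ {a a'} → val a' ≈ i (AT.val a) → ∀ n → i (AT.val (a AT.^ℤ n)) ≈ val (a' ^ℤ n)
  i-^ℤ e (+ n)          = i-pow* e n
  i-^ℤ {a} e -[1+ n ]   = i-pow* (trans (⁻¹-cong e) (sym (i-⁻¹ a))) (suc n)

  preimage : NZ → AT.NZ
  preimage y = AT.nz x x≉0
    where
      x = proj₁ (surjective (val y))
      x≉0 : ¬ (x A.≈ A.0#)
      x≉0 x≈0 = val≉0 y (trans (sym (proj₂ (surjective (val y)) A.refl)) (trans (⟦⟧-cong x≈0) 0#-homo))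

  i-preimage : ∀ y → i (AT.val (preimage y)) ≈ val y
  i-preimage y = proj₂ (surjective (val y)) A.refl

module ChoiceFunctionProperties {c ℓ} (F : Field c ℓ) (q : FieldTheory.NZ F)
  (ch : Torus.ChoiceFunction F q) where
  open Field F
  open FieldTheory F
  open Torus F q
  open ChoiceFunction ch

  φ-cong : ∀ {x y} → val x ≈ val y → val (φ x) ≈ val (φ y)
  φ-cong x≈y = φ-const _ _ (+0 , sym (trans (*-identityˡ _) x≈y))

  φ-fixes-Φ : ∀ {u} → InΦ ch u → val (φ u) ≈ val u
  φ-fixes-Φ {u} (x , φx≈u) =
    trans (sym (φ-const x u (proj₁ (φ-coset x) , trans (sym φx≈u) (proj₂ (φ-coset x))))) φx≈u

  Φ-coset-unique : ∀ u u₂ → InΦ ch u → InΦ ch u₂ → InCoset u u₂ → val u ≈ val u₂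
  Φ-coset-unique u u₂ u∈Φ u₂∈Φ u₂∈uΓ =
    trans (sym (φ-fixes-Φ u∈Φ)) (trans (φ-const u u₂ u₂∈uΓ) (φ-fixes-Φ u₂∈Φ))

module QuantumTorusIsomorphism {c ℓ c' ℓ'} (F : Field c ℓ) (F' : Field c' ℓ')
  (q : FieldTheory.NZ F) (q' : FieldTheory.NZ F')
  (q'-notRoot : FieldTheory.NotRootOfUnity F' (FieldTheory.NZ.val q'))
  (i : Field.Carrier F → Field.Carrier F') (i-iso : IsFieldIsomorphism F F' i)
  (iq≈q' : Field._≈_ F' (i (FieldTheory.NZ.val q)) (FieldTheory.NZ.val q'))
  (φ : Torus.ChoiceFunction F q) (φ' : Torus.ChoiceFunction F' q') where

  private
    module A  = Field F
    module AT = FieldTheory F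
    module T  = Torus F q
    module T' = Torus F' q'
    module Ch  = Torus.ChoiceFunction φ
    module Ch' = Torus.ChoiceFunction φ'
  open Field F'
  open FieldTheory F'
  open FieldInverses F'
  open IntegerPowers F' q' renaming (a^ to Q)
  open FieldIsomorphism F F' i i-iso
  open SetoidReasoning setoid
  open CommSemigroupProperties *-commutativeSemigroup using (xy∙z≈xz∙y; interchange)

  Q-cong : ∀ {m n} → m ≡ n → Q m ≈ Q n
  Q-cong m≡n = reflexive (≡.cong Q m≡n)

  i-q^ : ∀ n → i (AT.val (q AT.^ℤ n)) ≈ Q n
  i-q^ = i-^ℤ (sym iq≈q')

  τ : AT.NZ → NZ
  τ u = Ch'.φ (i-NZ u)

  private
    κ : AT.NZ → ℤ
    κ u = proj₁ (Ch'.φ-coset (i-NZ u))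

    τ≈q'^κ·i : ∀ u → val (τ u) ≈ Q (κ u) * i (AT.val u)
    τ≈q'^κ·i u = proj₂ (Ch'.φ-coset (i-NZ u))

  δ : AT.NZ → ℤ
  δ u = -ℤ κ u

  i≈q'^δ·τ : ∀ u → i (AT.val u) ≈ Q (δ u) * val (τ u)
  i≈q'^δ·τ u = begin
    i (AT.val u)                        ≈⟨ *-identityˡ _ ⟨
    1# * i (AT.val u)                   ≈⟨ *-congʳ (trans (*-comm _ _) (^ℤ-inverseʳ (κ u))) ⟨
    (Q (δ u) * Q (κ u)) * i (AT.val u)  ≈⟨ *-assoc _ _ _ ⟩
    Q (δ u) * (Q (κ u) * i (AT.val u))  ≈⟨ *-congˡ (τ≈q'^κ·i u) ⟨
    Q (δ u) * val (τ u)                 ∎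

  τ-cong : ∀ u u₂ → AT.val u A.≈ AT.val u₂ → val (τ u) ≈ val (τ u₂)
  τ-cong _ _ u≈u₂ = ChoiceFunctionProperties.φ-cong F' q' φ' (⟦⟧-cong u≈u₂)

  δ-cong : ∀ u u₂ → AT.val u A.≈ AT.val u₂ → δ u ≡ δ u₂
  δ-cong u u₂ u≈u₂ = ≡.cong -ℤ_ (^ℤ-injective q'-notRoot (κ u) (κ u₂)
    (*-cancelʳ (i-NZ u) (begin
      Q (κ u) * i (AT.val u)    ≈⟨ τ≈q'^κ·i u ⟨
      val (τ u)                 ≈⟨ τ-cong u u₂ u≈u₂ ⟩
      val (τ u₂)                ≈⟨ τ≈q'^κ·i u₂ ⟩
      Q (κ u₂) * i (AT.val u₂)  ≈⟨ *-congˡ (⟦⟧-cong u≈u₂) ⟨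
      Q (κ u₂) * i (AT.val u)   ∎)))

  τ∈Φ' : ∀ u → T'.InΦ φ' (τ u)
  τ∈Φ' u = i-NZ u , refl

  τ-injective : ∀ u u₂ → T.InΦ φ u → T.InΦ φ u₂ →
                val (τ u) ≈ val (τ u₂) → AT.val u A.≈ AT.val u₂
  τ-injective u u₂ u∈Φ u₂∈Φ τu≈τu₂ =
    ChoiceFunctionProperties.Φ-coset-unique F q φ u u₂ u∈Φ u₂∈Φ (j , injective (begin
      i (AT.val u₂)                         ≈⟨ i≈q'^δ·τ u₂ ⟩
      Q (δ u₂) * val (τ u₂)                 ≈⟨ *-congˡ τu≈τu₂ ⟨
      Q (δ u₂) * val (τ u)                  ≈⟨ *-congˡ (τ≈q'^κ·i u) ⟩
      Q (δ u₂) * (Q (κ u) * i (AT.val u))   ≈⟨ *-assoc _ _ _ ⟨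
      (Q (δ u₂) * Q (κ u)) * i (AT.val u)   ≈⟨ *-congʳ (^ℤ-+ (δ u₂) (κ u)) ⟨
      Q j * i (AT.val u)                    ≈⟨ *-congʳ (i-q^ j) ⟨
      i (AT.val (q AT.^ℤ j)) * i (AT.val u) ≈⟨ *-homo _ _ ⟨
      i (AT.val (q AT.^ℤ j) A.* AT.val u)   ∎))
    where j = δ u₂ +ℤ κ u

  τ-onto : ∀ u' → T'.InΦ φ' u' → ∃ λ u → T.InΦ φ u × val (τ u) ≈ val u'
  τ-onto u' (x , φ'x≈u') = u , (x₀ , A.refl) , trans τu≈φ'x φ'x≈u'
    where
      x₀ = preimage x
      u  = Ch.φ x₀
      n  = proj₁ (Ch.φ-coset x₀)
      τu≈φ'x : val (τ u) ≈ val (Ch'.φ x)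
      τu≈φ'x = sym (Ch'.φ-const x (i-NZ u) (n , (begin
        i (AT.val u)                              ≈⟨ ⟦⟧-cong (proj₂ (Ch.φ-coset x₀)) ⟩
        i (AT.val (q AT.^ℤ n) A.* AT.val x₀)      ≈⟨ *-homo _ _ ⟩
        i (AT.val (q AT.^ℤ n)) * i (AT.val x₀)    ≈⟨ *-cong (i-q^ n) (i-preimage x) ⟩
        Q n * val x                               ∎)))

  δ-cong₂ : ∀ u u₂ v v₂ → AT.val u A.≈ AT.val u₂ → AT.val v A.≈ AT.val v₂ →
            (f : ℤ → ℤ → ℤ) → f (δ u) (δ v) ≡ f (δ u₂) (δ v₂)
  δ-cong₂ u u₂ v v₂ u≈u₂ v≈v₂ f = ≡.cong₂ f (δ-cong u u₂ u≈u₂) (δ-cong v v₂ v≈v₂)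

  i-InΓ : ∀ c r → T.InΓ c ⇔ T'.InΓ (i-NZ c · q' ^ℤ r)
  i-InΓ c r = mk⇔ to from
    where
      to : T.InΓ c → T'.InΓ (i-NZ c · q' ^ℤ r)
      to (n , c≈q^n) = n +ℤ r , (begin
        i (AT.val c) * Q r  ≈⟨ *-congʳ (trans (⟦⟧-cong c≈q^n) (i-q^ n)) ⟩
        Q n * Q r           ≈⟨ ^ℤ-+ n r ⟨
        Q (n +ℤ r)          ∎)
      from : T'.InΓ (i-NZ c · q' ^ℤ r) → T.InΓ c
      from (n , ic·q'^r≈q'^n) = n -ℤ r , injective (begin
        i (AT.val c)                     ≈⟨ *-identityʳ _ ⟨
        i (AT.val c) * 1#                ≈⟨ *-congˡ (^ℤ-inverseʳ r) ⟨
        i (AT.val c) * (Q r * Q (-ℤ r))  ≈⟨ *-assoc _ _ _ ⟨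
        (i (AT.val c) * Q r) * Q (-ℤ r)  ≈⟨ *-congʳ ic·q'^r≈q'^n ⟩
        Q n * Q (-ℤ r)                   ≈⟨ ^ℤ-+ n (-ℤ r) ⟨
        Q (n -ℤ r)                       ≈⟨ i-q^ (n -ℤ r) ⟨
        i (AT.val (q AT.^ℤ (n -ℤ r)))    ∎)

  private
    _≈ᴱ_ : T.Elt φ → T.Elt φ → Set ℓ
    _≈ᴱ_ = T._≈E_ φ
    _≈ᴱ'_ : T'.Elt φ' → T'.Elt φ' → Set ℓ'
    _≈ᴱ'_ = T'._≈E_ φ'

  transport : (ℤ → ℤ → ℤ) → (ℤ → ℤ → ℤ → ℤ) → T.Elt φ → T'.Elt φ'
  transport shift weight (T.elt c m u v _ _) =
    T'.elt (i-NZ c · q' ^ℤ weight (δ u) (δ v) m) (m +ℤ shift (δ u) (δ v))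
           (τ u) (τ v) (τ∈Φ' u) (τ∈Φ' v)

  module _ (shift : ℤ → ℤ → ℤ) (weight : ℤ → ℤ → ℤ → ℤ) where

    transport-cong : ∀ a b → a ≈ᴱ b → transport shift weight a ≈ᴱ' transport shift weight b
    transport-cong (T.elt c m u v _ _) (T.elt c₂ _ u₂ v₂ _ _) (c≈c₂ , ≡.refl , u≈u₂ , v≈v₂) =
      *-cong (⟦⟧-cong c≈c₂) (Q-cong (on-δ (λ a b → weight a b m))) ,
      on-δ (λ a b → m +ℤ shift a b) , τ-cong u u₂ u≈u₂ , τ-cong v v₂ v≈v₂
      where on-δ = δ-cong₂ u u₂ v v₂ u≈u₂ v≈v₂

    transport-injective : ∀ a b → transport shift weight a ≈ᴱ' transport shift weight b → a ≈ᴱ b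
    transport-injective (T.elt c m u v u∈Φ v∈Φ) (T.elt c₂ m₂ u₂ v₂ u₂∈Φ v₂∈Φ) (ec , em , eu , ev) =
      c≈c₂ , m≡m₂ , u≈u₂ , v≈v₂
      where
        u≈u₂ = τ-injective u u₂ u∈Φ u₂∈Φ eu
        v≈v₂ = τ-injective v v₂ v∈Φ v₂∈Φ ev
        on-δ = δ-cong₂ u u₂ v v₂ u≈u₂ v≈v₂
        m≡m₂ : m ≡ m₂
        m≡m₂ = ℤ+.∙-cancelʳ (shift (δ u) (δ v)) m m₂
                 (≡.trans em (≡.cong (m₂ +ℤ_) (≡.sym (on-δ shift))))
        weight≡ : weight (δ u) (δ v) m ≡ weight (δ u₂) (δ v₂) m₂
        weight≡ = ≡.trans (on-δ (λ a b → weight a b m)) (≡.cong (weight _ _) m≡m₂)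
        c≈c₂ : AT.val c A.≈ AT.val c₂
        c≈c₂ = injective (*-cancelʳ (q' ^ℤ weight (δ u) (δ v) m)
          (trans ec (*-congˡ (Q-cong (≡.sym weight≡)))))

    transport-onto : ∀ b → ∃ λ a → transport shift weight a ≈ᴱ' b
    transport-onto (T'.elt c' m' u' v' u'∈Φ' v'∈Φ') with τ-onto u' u'∈Φ' | τ-onto v' v'∈Φ'
    ... | u , u∈Φ , τu≈u' | v , v∈Φ , τv≈v' =
      T.elt c₀ m u v u∈Φ v∈Φ , ic₀·q'^r≈c' , ℤ+.//-rightDividesˡ (shift (δ u) (δ v)) m'
      , τu≈u' , τv≈v'
      where
        m = m' -ℤ shift (δ u) (δ v)
        r = weight (δ u) (δ v) m
        c₀ = preimage (c' · q' ^ℤ (-ℤ r))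
        ic₀·q'^r≈c' : i (AT.val c₀) * Q r ≈ val c'
        ic₀·q'^r≈c' = begin
          i (AT.val c₀) * Q r         ≈⟨ *-congʳ (i-preimage (c' · q' ^ℤ (-ℤ r))) ⟩
          (val c' * Q (-ℤ r)) * Q r  ≈⟨ *-assoc _ _ _ ⟩
          val c' * (Q (-ℤ r) * Q r)  ≈⟨ *-congˡ (trans (*-comm _ _) (^ℤ-inverseʳ r)) ⟩
          val c' * 1#                ≈⟨ *-identityʳ _ ⟩
          val c'                     ∎

    transport-bijection : BijectionOn F F' q q' φ φ' (transport shift weight)
    transport-bijection = transport-cong , transport-injective , transport-onto

    transport-semilinear : ∀ x x' a → val x' ≈ i (AT.val x) →
      transport shift weight (T._∙_ φ x a) ≈ᴱ' T'._∙_ φ' x' (transport shift weight a)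
    transport-semilinear x x' (T.elt c m u v _ _) x'≈ix =
      trans (*-congʳ (trans (*-homo _ _) (*-congʳ (sym x'≈ix)))) (*-assoc _ _ _) , ≡.refl , refl , refl

    transport-InBasis : ∀ a → T.InBasis φ a ⇔ T'.InBasis φ' (transport shift weight a)
    transport-InBasis (T.elt c m u v _ _) = i-InΓ c (weight (δ u) (δ v) m)

  U-shift V-shift : ℤ → ℤ → ℤ
  U-shift δu δv = δu
  V-shift δu δv = δv

  U-weight V-weight : ℤ → ℤ → ℤ → ℤ
  U-weight δu δv m = δv *ℤ m
  V-weight δu δv n = -ℤ (δu *ℤ (n +ℤ δv))

  fU fV : T.Elt φ → T'.Elt φ'
  fU = transport U-shift U-weight
  fV = transport V-shift V-weight

  coef-step : ∀ c {X Y} p r → i X * Q r ≈ Q p * Y → i (c A.* X) * Q r ≈ (i c * Q p) * Y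
  coef-step c {X} {Y} p r iX·q'^r≈q'^p·Y = begin
    i (c A.* X) * Q r  ≈⟨ *-congʳ (*-homo c X) ⟩
    (i c * i X) * Q r  ≈⟨ *-assoc _ _ _ ⟩
    i c * (i X * Q r)  ≈⟨ *-congˡ iX·q'^r≈q'^p·Y ⟩
    i c * (Q p * Y)    ≈⟨ *-assoc _ _ _ ⟨
    (i c * Q p) * Y    ∎

  ⁻¹-step : ∀ w w' p r → i (AT.val w) * Q p ≈ Q r * val w' →
            i (AT.val (w AT.⁻¹)) * Q r ≈ Q p * val (w' ⁻¹)
  ⁻¹-step w w' _ _ e = trans (*-congʳ (i-⁻¹ w)) (⁻¹-swap (i-NZ w) w' e)

  i-shift : ∀ w {s p} → δ w +ℤ s ≡ p → i (AT.val w) * Q s ≈ Q p * val (τ w)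
  i-shift w {s} {p} δw+s≡p = begin
    i (AT.val w) * Q s               ≈⟨ *-congʳ (i≈q'^δ·τ w) ⟩
    (Q (δ w) * val (τ w)) * Q s      ≈⟨ xy∙z≈xz∙y _ _ _ ⟩
    (Q (δ w) * Q s) * val (τ w)      ≈⟨ *-congʳ (^ℤ-+ (δ w) s) ⟨
    Q (δ w +ℤ s) * val (τ w)         ≈⟨ *-congʳ (Q-cong δw+s≡p) ⟩
    Q p * val (τ w)                  ∎

  i-q^· : ∀ m w r → i (AT.val (q AT.^ℤ m AT.· w)) * Q r ≈ Q r * val (q' ^ℤ (m +ℤ δ w) · τ w)
  i-q^· m w r = trans (*-comm _ _) (*-congˡ (begin
    i (AT.val (q AT.^ℤ m) A.* AT.val w)    ≈⟨ *-homo _ _ ⟩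
    i (AT.val (q AT.^ℤ m)) * i (AT.val w)  ≈⟨ *-cong (i-q^ m) (i≈q'^δ·τ w) ⟩
    Q m * (Q (δ w) * val (τ w))            ≈⟨ *-assoc _ _ _ ⟨
    (Q m * Q (δ w)) * val (τ w)            ≈⟨ *-congʳ (^ℤ-+ m (δ w)) ⟨
    Q (m +ℤ δ w) * val (τ w)               ∎))

  private
    index-swap : ∀ m a b → (m +ℤ a) +ℤ b ≡ (m +ℤ b) +ℤ a
    index-swap = CommSemigroupProperties.xy∙z≈xz∙y ℤ.+-commutativeSemigroup

  fU-U : ∀ a → fU (T.U-onU φ a) ≈ᴱ' T'.U-onU φ' (fU a)
  fU-U (T.elt c m u v _ _) = coef-step (AT.val c) (w m) (w m) (i-q^· m u (w m)) , ≡.refl , refl , refl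
    where w = U-weight (δ u) (δ v)

  fU-U⁻¹ : ∀ a → fU (T.U⁻¹-onU φ a) ≈ᴱ' T'.U⁻¹-onU φ' (fU a)
  fU-U⁻¹ (T.elt c m u v _ _) =
    coef-step (AT.val c) (w m) (w m) (⁻¹-step (q AT.^ℤ m AT.· u) _ (w m) (w m) (i-q^· m u (w m)))
    , ≡.refl , refl , refl
    where w = U-weight (δ u) (δ v)

  fU-V : ∀ a → fU (T.V-onU φ a) ≈ᴱ' T'.V-onU φ' (fU a)
  fU-V (T.elt c m u v _ _) =
    coef-step (AT.val c) (w m) (w (m -ℤ 1ℤ)) (i-shift v (step (δ v) m))
    , index-swap m _ (δ u) , refl , refl
    where
      w = U-weight (δ u) (δ v)
      step : ∀ b m → b +ℤ b *ℤ (m -ℤ 1ℤ) ≡ b *ℤ m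
      step = solve-∀

  fU-V⁻¹ : ∀ a → fU (T.V⁻¹-onU φ a) ≈ᴱ' T'.V⁻¹-onU φ' (fU a)
  fU-V⁻¹ (T.elt c m u v _ _) =
    coef-step (AT.val c) (w m) (w (m +ℤ 1ℤ))
      (⁻¹-step v (τ v) (w m) (w (m +ℤ 1ℤ)) (i-shift v (step (δ v) m)))
    , index-swap m _ (δ u) , refl , refl
    where
      w = U-weight (δ u) (δ v)
      step : ∀ b m → b +ℤ b *ℤ m ≡ b *ℤ (m +ℤ 1ℤ)
      step = solve-∀

  fV-U : ∀ a → fV (T.U-onV φ a) ≈ᴱ' T'.U-onV φ' (fV a)
  fV-U (T.elt c n u v _ _) =
    coef-step (AT.val c) (w n) (w (n +ℤ 1ℤ)) (i-shift u (step (δ u) (δ v) n))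
    , index-swap n _ (δ v) , refl , refl
    where
      w = V-weight (δ u) (δ v)
      step : ∀ a b n → a +ℤ -ℤ (a *ℤ ((n +ℤ 1ℤ) +ℤ b)) ≡ -ℤ (a *ℤ (n +ℤ b))
      step = solve-∀

  fV-U⁻¹ : ∀ a → fV (T.U⁻¹-onV φ a) ≈ᴱ' T'.U⁻¹-onV φ' (fV a)
  fV-U⁻¹ (T.elt c n u v _ _) =
    coef-step (AT.val c) (w n) (w (n -ℤ 1ℤ))
      (⁻¹-step u (τ u) (w n) (w (n -ℤ 1ℤ)) (i-shift u (step (δ u) (δ v) n)))
    , index-swap n _ (δ v) , refl , refl
    where
      w = V-weight (δ u) (δ v)
      step : ∀ a b n → a +ℤ -ℤ (a *ℤ (n +ℤ b)) ≡ -ℤ (a *ℤ ((n -ℤ 1ℤ) +ℤ b))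
      step = solve-∀

  fV-V : ∀ a → fV (T.V-onV φ a) ≈ᴱ' T'.V-onV φ' (fV a)
  fV-V (T.elt c n u v _ _) = coef-step (AT.val c) (w n) (w n) (i-q^· n v (w n)) , ≡.refl , refl , refl
    where w = V-weight (δ u) (δ v)

  fV-V⁻¹ : ∀ a → fV (T.V⁻¹-onV φ a) ≈ᴱ' T'.V⁻¹-onV φ' (fV a)
  fV-V⁻¹ (T.elt c n u v _ _) =
    coef-step (AT.val c) (w n) (w n) (⁻¹-step (q AT.^ℤ n AT.· v) _ (w n) (w n) (i-q^· n v (w n)))
    , ≡.refl , refl , refl
    where w = V-weight (δ u) (δ v)

  pairing-domain : PairingDomain F F' q q' φ φ' i fU fV
  pairing-domain (T.elt _ _ u v u∈Φ v∈Φ) (T.elt _ _ u₂ v₂ u₂∈Φ v₂∈Φ) _ _ = mk⇔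
    (λ (u≈u₂ , v≈v₂) → τ-cong u u₂ u≈u₂ , τ-cong v v₂ v≈v₂)
    (λ (τu≈τu₂ , τv≈τv₂) →
       τ-injective u u₂ u∈Φ u₂∈Φ τu≈τu₂ , τ-injective v v₂ v∈Φ v₂∈Φ τv≈τv₂)

  pairing-UV : PairingValueUV F F' q q' φ φ' i fU fV
  pairing-UV (T.elt c m u v _ _) (T.elt d n u₂ v₂ _ _) _ _ (u≈u₂ , v≈v₂) = begin
    i ((AT.val (c AT.⁻¹) A.* AT.val d) A.* AT.val (q AT.^ℤ (m *ℤ n)))
      ≈⟨ *-homo _ _ ⟩
    i (AT.val (c AT.⁻¹) A.* AT.val d) * i (AT.val (q AT.^ℤ (m *ℤ n)))
      ≈⟨ *-cong (trans (*-homo _ _) (*-congʳ (i-⁻¹ c))) (i-q^ (m *ℤ n)) ⟩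
    (ic⁻¹ * i-d) * Q (m *ℤ n)
      ≈⟨ *-congˡ (Q-cong exponent) ⟨
    (ic⁻¹ * i-d) * Q ((-ℤ r +ℤ B) +ℤ M)
      ≈⟨ *-congˡ (trans (^ℤ-+ (-ℤ r +ℤ B) M) (*-congʳ (^ℤ-+ (-ℤ r) B))) ⟩
    (ic⁻¹ * i-d) * ((Q (-ℤ r) * Q B) * Q M)
      ≈⟨ *-assoc _ _ _ ⟨
    ((ic⁻¹ * i-d) * (Q (-ℤ r) * Q B)) * Q M
      ≈⟨ *-congʳ (interchange _ _ _ _) ⟩
    ((ic⁻¹ * Q (-ℤ r)) * (i-d * Q B)) * Q M
      ≈⟨ *-congʳ (*-congʳ (trans (⁻¹-distrib-· (i-NZ c) (q' ^ℤ r)) (*-congˡ (^ℤ-⁻¹ r)))) ⟨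
    (val ((i-NZ c · q' ^ℤ r) ⁻¹) * (i-d * Q B)) * Q M
      ∎
    where
      ic⁻¹ = val (i-NZ c ⁻¹)
      i-d  = i (AT.val d)
      r    = U-weight (δ u) (δ v) m
      B    = V-weight (δ u₂) (δ v₂) n
      M    = (m +ℤ δ u) *ℤ (n +ℤ δ v₂)
      cancel : ∀ a b m n → (-ℤ (b *ℤ m) +ℤ -ℤ (a *ℤ (n +ℤ b))) +ℤ (m +ℤ a) *ℤ (n +ℤ b) ≡ m *ℤ n
      cancel = solve-∀
      exponent : (-ℤ r +ℤ B) +ℤ M ≡ m *ℤ n
      exponent = ≡.trans
        (δ-cong₂ u₂ u v₂ v (A.sym u≈u₂) (A.sym v≈v₂)
          (λ a b → (-ℤ r +ℤ V-weight a b n) +ℤ (m +ℤ δ u) *ℤ (n +ℤ b)))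
        (cancel (δ u) (δ v) m n)

  pairing-VU : PairingValueVU F F' q q' φ φ' i fU fV
  pairing-VU a b a∈U b∈V a~b = trans (i-⁻¹ _) (⁻¹-cong (pairing-UV a b a∈U b∈V a~b))

  torusIsomorphism : TorusIsomorphism F F' q q' φ φ' i
  torusIsomorphism =
    fU , fV , transport-bijection U-shift U-weight , transport-bijection V-shift V-weight
    , (transport-semilinear U-shift U-weight , transport-semilinear V-shift V-weight)
    , (fU-U , fU-U⁻¹ , fU-V , fU-V⁻¹ , fV-U , fV-U⁻¹ , fV-V , fV-V⁻¹)
    , (transport-InBasis U-shift U-weight , transport-InBasis V-shift V-weight)
    , (pairing-domain , pairing-UV , pairing-VU)

mainTheorem4 : ∀ {c ℓ c' ℓ'} (F : Field c ℓ) (F' : Field c' ℓ')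
    → FieldTheory.CharZero F → FieldTheory.CharZero F'
    → (q : FieldTheory.NZ F) (q' : FieldTheory.NZ F')
    → FieldTheory.NotRootOfUnity F (FieldTheory.NZ.val q)
    → FieldTheory.NotRootOfUnity F' (FieldTheory.NZ.val q')
    → (i : Field.Carrier F → Field.Carrier F')
    → IsFieldIsomorphism F F' i
    → Field._≈_ F' (i (FieldTheory.NZ.val q)) (FieldTheory.NZ.val q')
    → (φ : Torus.ChoiceFunction F q) (φ' : Torus.ChoiceFunction F' q')
    → TorusIsomorphism F F' q q' φ φ' i
mainTheorem4 F F' _ _ q q' _ q'-notRoot i i-iso iq≈q' φ φ' =
  QuantumTorusIsomorphism.torusIsomorphism F F' q q' q'-notRoot i i-iso iq≈q' φ φ'
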